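{- Let $G$ be a bipartite graph with labelled partite sets of size $n$ each, and let $k$ be a positive integer. Suppose $(A_1,\dots,A_n,B_1,\dots,B_n)$ is a reduced $k$-min-difference representation of $G$, where $A_1,\dots,A_n$ represent the vertices of one part and $B_1,\dots,B_n$ those of the other. Then \[ \Bigl|\Bigl(\bigcup_i A_i\Bigr)\cup\Bigl(\bigcup_i B_i\Bigr)\Bigr|\le 4kn. \]
   Context: A $k$-min-difference representation of a graph $G$ is an assignment of a finite set $A_v$ to each vertex $v$ such that for distinct $u,v$: $uv\in E(G)$ iff $\min\{|A_u\setminus A_v|,|A_v\setminus A_u|\}\ge k$. Such a representation is reduced if for every element $x$ of the union of all the sets, deleting $x$ from all sets containing it yields a $k$-min-difference representation of a graph different from $G$. -}

module Defs where

open import Data.Nat using (ℕ; _≥_)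
open import Data.Fin using (Fin)
open import Data.Fin.Subset using (Subset; _─_; _-_; ∣_∣; ⋃; _∈_)
open import Data.Sum using (_⊎_; inj₁; inj₂)
open import Data.Product using (_×_)
open import Data.List using (List; map; allFin; _++_)
open import Relation.Nullary using (¬_)
open import Relation.Binary.PropositionalEquality using (_≡_)
open import Function.Bundles using (_⇔_)

record Graph (V : Set) : Set₁ where
  field
    Adj    : V → V → Set
    sym    : ∀ {u v} → Adj u v → Adj v u
    irrefl : ∀ {v} → ¬ Adj v v
open Graph public

-- Vertices of a bipartite graph with labelled partite sets of size n each:
-- inj₁ i is the i-th vertex of the first part (represented by A_i),
-- inj₂ i is the i-th vertex of the second part (represented by B_i).
BVert : ℕ → Set
BVert n = Fin n ⊎ Fin n

IsBipartite : ∀ {n} → Graph (BVert n) → Set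
IsBipartite {n} G =
  (∀ (i j : Fin n) → ¬ Adj G (inj₁ i) (inj₁ j)) ×
  (∀ (i j : Fin n) → ¬ Adj G (inj₂ i) (inj₂ j))

-- Finite sets are modelled as subsets of a finite ground set Fin m
-- (every finite family of finite sets lives in such a ground set).
-- min{|S \ T|, |T \ S|} ≥ k, written as both differences having size ≥ k.
MinDiff : ∀ {m} → ℕ → Subset m → Subset m → Set
MinDiff k S T = (∣ S ─ T ∣ ≥ k) × (∣ T ─ S ∣ ≥ k)

IsKMinDiffRep : ∀ {V : Set} {m} → ℕ → Graph V → (V → Subset m) → Set
IsKMinDiffRep {V} k G F =
  ∀ (u v : V) → ¬ u ≡ v → Adj G u v ⇔ MinDiff k (F u) (F v)

delete : ∀ {V : Set} {m} → Fin m → (V → Subset m) → (V → Subset m)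
delete x F v = F v - x

unionOver : ∀ {V : Set} {m} → List V → (V → Subset m) → Subset m
unionOver vs F = ⋃ (map F vs)

allBVert : (n : ℕ) → List (BVert n)
allBVert n = map inj₁ (allFin n) ++ map inj₂ (allFin n)

-- Reduced: for every x in the union, deleting x yields a k-min-difference
-- representation of a graph different from G, i.e. the family after deletion
-- no longer represents G (the graph it represents is uniquely determined).
IsReduced : ∀ {n m} → ℕ → Graph (BVert n) → (BVert n → Subset m) → Set
IsReduced {n} k G F =
  ∀ x → x ∈ unionOver (allBVert n) F → ¬ IsKMinDiffRep k G (delete x F)

-- Call x critical for an edge uv if x ∈ F u ─ F v and |F u ─ F v| ≤ k (so = k).
-- Deleting an element that is critical for no edge keeps both differences of
-- every edge of size ≥ k and only shrinks the differences of non-edges, so it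
-- preserves the representation; hence in a reduced representation every
-- element is critical for some edge.
--
--  * A part is independent, so no two of its sets differ by ≥ k both ways.
--    Such a family P₁…Pₙ has a ranked cover: a rank on indices and a set D,
--    |D| ≤ nk, containing Pᵢ ─ Pᵢ' whenever rank i ≤ rank i'.  It is built by
--    induction on n, removing a largest set and ranking it on top.
--  * Given a ranked cover of the Aᵢ and a set Bⱼ, every critical difference
--    Aᵢ ─ Bⱼ lies in D together with the critical difference of top rank
--    (≤ k elements).  So the critical elements of the edges AᵢBⱼ lie in a set
--    of size ≤ nk + nk; symmetrically for BⱼAᵢ, giving 4kn in total.
module Submission where

open import Defs
open import Data.Nat using (ℕ; _≤_; _*_)
open import Data.Fin.Subset using (Subset; ∣_∣)

open import Data.Nat using (zero; suc; _+_; _<_; _≤?_; z≤n)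
open import Data.Nat.Properties
  using (≤-refl; ≤-reflexive; ≤-trans; ≤-pred; <⇒≤; <⇒≱; ≰⇒>; m<n⇒m<1+n;
         +-suc; +-mono-≤; +-monoˡ-≤; +-monoʳ-≤; +-cancelˡ-≤; module ≤-Reasoning)
open import Data.Nat.Tactic.RingSolver using (solve-∀)
open import Data.Bool using (true; false)
open import Data.Fin using (Fin; zero; suc; punchIn; punchOut)
open import Data.Fin.Properties using (punchIn-punchOut; _≟_)
open import Data.Fin.Subset using (_∪_; _─_; _-_; ⁅_⁆; _∈_; _∉_; _⊆_; ⋃; ⊥)
open import Data.Fin.Subset.Properties
  using (x∈p∪q⁺; x∈p∪q⁻; ∪-comm; p─q⊆p; x∈p∧x∉q⇒x∈p─q; x∈p∧x≢y⇒x∈p-y;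
         ∣p─q∣≤∣p∣; ∣q∣≤∣p∪q∣; ∣⊥∣≡0; ∣⁅x⁆∣≡1; p⊆q⇒∣p∣≤∣q∣; _∈?_)
open import Data.List using (tabulate)
open import Data.Vec using ([]; _∷_; here; there)
open import Data.Product using (Σ-syntax; _×_; _,_; proj₁; proj₂)
open import Data.Sum using (_⊎_; inj₁; inj₂)
open import Data.Empty using (⊥-elim)
open import Data.Unit using (⊤)
open import Relation.Nullary using (¬_; yes; no; contradiction)
open import Relation.Unary using (Decidable)
open import Relation.Binary.PropositionalEquality
  using (_≡_; _≢_; refl; trans; cong; subst)
  renaming (sym to ≡-sym)
open import Function.Bundles using (mk⇔; Equivalence)

private variable m n : ℕ

∣p∪q∣≡∣p∣+∣q─p∣ : (p q : Subset m) → ∣ p ∪ q ∣ ≡ ∣ p ∣ + ∣ q ─ p ∣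
∣p∪q∣≡∣p∣+∣q─p∣ [] [] = refl
∣p∪q∣≡∣p∣+∣q─p∣ (true ∷ p) (true ∷ q) = cong suc (∣p∪q∣≡∣p∣+∣q─p∣ p q)
∣p∪q∣≡∣p∣+∣q─p∣ (true ∷ p) (false ∷ q) = cong suc (∣p∪q∣≡∣p∣+∣q─p∣ p q)
∣p∪q∣≡∣p∣+∣q─p∣ (false ∷ p) (true ∷ q) =
  trans (cong suc (∣p∪q∣≡∣p∣+∣q─p∣ p q)) (≡-sym (+-suc ∣ p ∣ ∣ q ─ p ∣))
∣p∪q∣≡∣p∣+∣q─p∣ (false ∷ p) (false ∷ q) = ∣p∪q∣≡∣p∣+∣q─p∣ p q

∣p∪q∣≤∣p∣+∣q∣ : (p q : Subset m) → ∣ p ∪ q ∣ ≤ ∣ p ∣ + ∣ q ∣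
∣p∪q∣≤∣p∣+∣q∣ p q = begin
  ∣ p ∪ q ∣          ≡⟨ ∣p∪q∣≡∣p∣+∣q─p∣ p q ⟩
  ∣ p ∣ + ∣ q ─ p ∣  ≤⟨ +-monoʳ-≤ ∣ p ∣ (∣p─q∣≤∣p∣ q p) ⟩
  ∣ p ∣ + ∣ q ∣      ∎
  where open ≤-Reasoning

-- The smaller of two sets has the smaller difference: both sides of
-- ∣q∣ + ∣p ─ q∣ = ∣p ∪ q∣ = ∣p∣ + ∣q ─ p∣ are compared.
smaller⇒∣p─q∣≤∣q─p∣ : (p q : Subset m) → ∣ p ∣ ≤ ∣ q ∣ → ∣ p ─ q ∣ ≤ ∣ q ─ p ∣
smaller⇒∣p─q∣≤∣q─p∣ p q ∣p∣≤∣q∣ = +-cancelˡ-≤ ∣ q ∣ _ _ (begin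
  ∣ q ∣ + ∣ p ─ q ∣  ≡⟨ ∣p∪q∣≡∣p∣+∣q─p∣ q p ⟨
  ∣ q ∪ p ∣          ≡⟨ cong ∣_∣ (∪-comm q p) ⟩
  ∣ p ∪ q ∣          ≡⟨ ∣p∪q∣≡∣p∣+∣q─p∣ p q ⟩
  ∣ p ∣ + ∣ q ─ p ∣  ≤⟨ +-monoˡ-≤ ∣ q ─ p ∣ ∣p∣≤∣q∣ ⟩
  ∣ q ∣ + ∣ q ─ p ∣  ∎)
  where open ≤-Reasoning

∣p─p∣≡0 : (p : Subset m) → ∣ p ─ p ∣ ≡ 0
∣p─p∣≡0 [] = refl
∣p─p∣≡0 (true ∷ p) = ∣p─p∣≡0 p
∣p─p∣≡0 (false ∷ p) = ∣p─p∣≡0 p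

x∈p─q⇒x∉q : (p q : Subset m) {x : Fin m} → x ∈ p ─ q → x ∉ q
x∈p─q⇒x∉q (_ ∷ p) (false ∷ q) here ()
x∈p─q⇒x∉q (_ ∷ p) (_ ∷ q) (there x∈p─q) (there x∈q) = x∈p─q⇒x∉q p q x∈p─q x∈q

─-distrib : (p q r : Subset m) → (p ─ r) ─ (q ─ r) ≡ (p ─ q) ─ r
─-distrib [] [] [] = refl
─-distrib (_ ∷ p) (_ ∷ q) (true ∷ r) = cong (_ ∷_) (─-distrib p q r)
─-distrib (_ ∷ p) (_ ∷ q) (false ∷ r) = cong (_ ∷_) (─-distrib p q r)

∣p∣≤1+∣p-x∣ : (p : Subset m) (x : Fin m) → ∣ p ∣ ≤ suc ∣ p - x ∣
∣p∣≤1+∣p-x∣ p x = begin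
  ∣ p ∣                      ≤⟨ ∣q∣≤∣p∪q∣ ⁅ x ⁆ p ⟩
  ∣ ⁅ x ⁆ ∪ p ∣              ≡⟨ ∣p∪q∣≡∣p∣+∣q─p∣ ⁅ x ⁆ p ⟩
  ∣ ⁅ x ⁆ ∣ + ∣ p - x ∣      ≡⟨ cong (_+ ∣ p - x ∣) (∣⁅x⁆∣≡1 x) ⟩
  suc ∣ p - x ∣              ∎
  where open ≤-Reasoning

deletion-keeps-large : (k : ℕ) (s : Subset m) (x : Fin m) →
  k ≤ ∣ s ∣ → (x ∈ s → k < ∣ s ∣) → k ≤ ∣ s - x ∣
deletion-keeps-large k s x k≤∣s∣ large with x ∈? s
... | yes x∈s = ≤-pred (≤-trans (large x∈s) (∣p∣≤1+∣p-x∣ s x))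
... | no x∉s = ≤-trans k≤∣s∣ (p⊆q⇒∣p∣≤∣q∣ s⊆s-x)
  where
  s⊆s-x : s ⊆ s - x
  s⊆s-x y∈s = x∈p∧x≢y⇒x∈p-y y∈s (λ { refl → x∉s y∈s })

⋃ᶠ : (Fin n → Subset m) → Subset m
⋃ᶠ f = ⋃ (tabulate f)

f⊆⋃ᶠf : (f : Fin n → Subset m) (i : Fin n) → f i ⊆ ⋃ᶠ f
f⊆⋃ᶠf f zero x∈fi = x∈p∪q⁺ (inj₁ x∈fi)
f⊆⋃ᶠf f (suc i) x∈fi = x∈p∪q⁺ (inj₂ (f⊆⋃ᶠf (λ j → f (suc j)) i x∈fi))

∣⋃ᶠ∣≤ : (k : ℕ) (f : Fin n → Subset m) → (∀ i → ∣ f i ∣ ≤ k) → ∣ ⋃ᶠ f ∣ ≤ n * k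
∣⋃ᶠ∣≤ {zero} {m} k f bound = ≤-reflexive (∣⊥∣≡0 m)
∣⋃ᶠ∣≤ {suc n} k f bound = ≤-trans (∣p∪q∣≤∣p∣+∣q∣ (f zero) _)
  (+-mono-≤ (bound zero) (∣⋃ᶠ∣≤ k (λ i → f (suc i)) (λ i → bound (suc i))))

MaxWitness : (P : Fin n → Set) (w : Fin n → ℕ) → Set
MaxWitness {n} P w = Σ[ j ∈ Fin n ] P j × (∀ i → P i → w i ≤ w j)

findMax : {P : Fin n → Set} → Decidable P → (w : Fin n → ℕ) →
  (∀ i → ¬ P i) ⊎ MaxWitness P w
findMax {zero} P? w = inj₁ λ ()
findMax {suc n} P? w with findMax (λ i → P? (suc i)) (λ i → w (suc i)) | P? zero
... | inj₁ none | no ¬P0 = inj₁ λ { zero → ¬P0 ; (suc i) → none i }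
... | inj₁ none | yes P0 =
  inj₂ (zero , P0 , λ { zero _ → ≤-refl ; (suc i) Pi → contradiction Pi (none i) })
... | inj₂ (j , Pj , max) | no ¬P0 =
  inj₂ (suc j , Pj , λ { zero P0 → contradiction P0 ¬P0 ; (suc i) Pi → max i Pi })
... | inj₂ (j , Pj , max) | yes P0 with w zero ≤? w (suc j)
...   | yes w0≤wj = inj₂ (suc j , Pj , λ { zero _ → w0≤wj ; (suc i) Pi → max i Pi })
...   | no w0≰wj =
  inj₂ (zero , P0 , λ { zero _ → ≤-refl ; (suc i) Pi → ≤-trans (max i Pi) (<⇒≤ (≰⇒> w0≰wj)) })

largest : (P : Fin (suc n) → Subset m) → Σ[ z ∈ Fin (suc n) ] (∀ i → ∣ P i ∣ ≤ ∣ P z ∣)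
largest P with findMax {P = λ _ → ⊤} (λ _ → yes _) (λ i → ∣ P i ∣)
... | inj₁ none = ⊥-elim (none zero _)
... | inj₂ (z , _ , max) = z , λ i → max i _

NoMutual : ℕ → (Fin n → Subset m) → Set
NoMutual {n} k P = ∀ (i j : Fin n) → ¬ MinDiff k (P i) (P j)

no-mutual⇒∣p─q∣<k : (k : ℕ) (p q : Subset m) →
  ¬ MinDiff k p q → ∣ p ∣ ≤ ∣ q ∣ → ∣ p ─ q ∣ < k
no-mutual⇒∣p─q∣<k k p q ¬md ∣p∣≤∣q∣ with k ≤? ∣ p ─ q ∣
... | yes k≤ = contradiction (k≤ , ≤-trans k≤ (smaller⇒∣p─q∣≤∣q─p∣ p q ∣p∣≤∣q∣)) ¬md
... | no k≰ = ≰⇒> k≰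

record RankedCover (P : Fin n → Subset m) (D : Subset m) : Set where
  field
    rank    : Fin n → ℕ
    rank<n  : ∀ i → rank i < n
    covers  : ∀ i i' → rank i ≤ rank i' → P i ─ P i' ⊆ D

-- With a ranked cover of P, the differences P i ─ q of size ≤ k all lie in D
-- plus one of them: if j has top rank among those i, then an element of
-- P i ─ q lies either in P j ─ q or in P i ─ P j ⊆ D.
critical-cover : (k : ℕ) (P : Fin n → Subset m) {D : Subset m} → RankedCover P D →
  (q : Subset m) →
  Σ[ K ∈ Subset m ] ∣ K ∣ ≤ k × (∀ i → ∣ P i ─ q ∣ ≤ k → P i ─ q ⊆ K ∪ D)
critical-cover {m = m} k P {D} rc q with findMax (λ i → ∣ P i ─ q ∣ ≤? k) (RankedCover.rank rc)
... | inj₁ none =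
  ⊥ , ≤-trans (≤-reflexive (∣⊥∣≡0 m)) z≤n , λ i small → contradiction small (none i)
... | inj₂ (j , small-j , top) = P j ─ q , small-j , cover
  where
  cover : ∀ i → ∣ P i ─ q ∣ ≤ k → P i ─ q ⊆ (P j ─ q) ∪ D
  cover i small {x} x∈ with x ∈? P j
  ... | yes x∈Pj = x∈p∪q⁺ (inj₁ (x∈p∧x∉q⇒x∈p─q x∈Pj (x∈p─q⇒x∉q (P i) q x∈)))
  ... | no x∉Pj = x∈p∪q⁺ (inj₂ (RankedCover.covers rc i j (top i small)
                                  (x∈p∧x∉q⇒x∈p─q (p─q⊆p (P i) q x∈) x∉Pj)))

data Around (z : Fin (suc n)) : Fin (suc n) → Set where
  at    : Around z z
  other : (a : Fin n) → Around z (punchIn z a)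

around : (z i : Fin (suc n)) → Around z i
around z i with z ≟ i
... | yes refl = at
... | no z≢i = subst (Around z) (punchIn-punchOut z≢i) (other (punchOut z≢i))

-- Putting P z on top of a ranked cover of the other sets: the cover only has
-- to be enlarged by a set K containing P i ─ P z for every other index i.
extend-ranked-cover : (P : Fin (suc n) → Subset m) (z : Fin (suc n)) {K D : Subset m} →
  RankedCover (λ a → P (punchIn z a)) D →
  (∀ a → P (punchIn z a) ─ P z ⊆ K ∪ D) → RankedCover P (K ∪ D)
extend-ranked-cover {n} P z {K} {D} rc below = record
  { rank = λ i → rankAt (around z i)
  ; rank<n = λ i → rankAt<1+n (around z i)
  ; covers = λ i i' → coversAt (around z i) (around z i')
  }
  where
  open RankedCover rc renaming (rank to rank′; rank<n to rank′<n; covers to covers′)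

  rankAt : ∀ {i} → Around z i → ℕ
  rankAt at = n
  rankAt (other a) = rank′ a

  rankAt<1+n : ∀ {i} (v : Around z i) → rankAt v < suc n
  rankAt<1+n at = ≤-refl
  rankAt<1+n (other a) = m<n⇒m<1+n (rank′<n a)

  coversAt : ∀ {i i'} (v : Around z i) (v' : Around z i') →
    rankAt v ≤ rankAt v' → P i ─ P i' ⊆ K ∪ D
  coversAt at at _ x∈ = contradiction (p─q⊆p (P z) (P z) x∈) (x∈p─q⇒x∉q (P z) (P z) x∈)
  coversAt at (other a') n≤rank = contradiction n≤rank (<⇒≱ (rank′<n a'))
  coversAt (other a) at _ = below a
  coversAt (other a) (other a') le x∈ = x∈p∪q⁺ (inj₂ (covers′ a a' le x∈))

-- The largest set P z differs from each other set by < k, so the extra set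
-- K needed on top of the cover of the rest is given by critical-cover.
ranked-cover : (k : ℕ) (P : Fin n → Subset m) → NoMutual k P →
  Σ[ D ∈ Subset m ] ∣ D ∣ ≤ n * k × RankedCover P D
ranked-cover {zero} {m} k P _ =
  ⊥ , ≤-reflexive (∣⊥∣≡0 m) , record { rank = λ () ; rank<n = λ () ; covers = λ () }
ranked-cover {suc n} {m} k P no-mutual =
  K ∪ D , ≤-trans (∣p∪q∣≤∣p∣+∣q∣ K D) (+-mono-≤ ∣K∣≤k ∣D∣≤nk) ,
  extend-ranked-cover P z rc below
  where
  z : Fin (suc n)
  z = proj₁ (largest P)

  rest : Fin n → Subset m
  rest a = P (punchIn z a)

  rest-cover : Σ[ D ∈ Subset m ] ∣ D ∣ ≤ n * k × RankedCover rest D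
  rest-cover = ranked-cover k rest (λ a a' → no-mutual (punchIn z a) (punchIn z a'))

  D : Subset m
  D = proj₁ rest-cover

  ∣D∣≤nk : ∣ D ∣ ≤ n * k
  ∣D∣≤nk = proj₁ (proj₂ rest-cover)

  rc : RankedCover rest D
  rc = proj₂ (proj₂ rest-cover)

  top-cover : Σ[ K ∈ Subset m ] ∣ K ∣ ≤ k × (∀ a → ∣ rest a ─ P z ∣ ≤ k → rest a ─ P z ⊆ K ∪ D)
  top-cover = critical-cover k rest rc (P z)

  K : Subset m
  K = proj₁ top-cover

  ∣K∣≤k : ∣ K ∣ ≤ k
  ∣K∣≤k = proj₁ (proj₂ top-cover)

  below : ∀ a → rest a ─ P z ⊆ K ∪ D
  below a = proj₂ (proj₂ top-cover) a (<⇒≤ (no-mutual⇒∣p─q∣<k k (rest a) (P z)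
    (no-mutual (punchIn z a) z) (proj₂ (largest P) (punchIn z a))))

CoversCritical : {I J : Set} → ℕ → (I → Subset m) → (J → Subset m) → Subset m → Set
CoversCritical k P Q C = ∀ i j → ∣ P i ─ Q j ∣ ≤ k → P i ─ Q j ⊆ C

-- For a family without mutual k-differences and any family Q, the critical
-- differences P i ─ Q j all lie in one set of size ≤ nk + nk: the ranked
-- cover of P together with one extra set of size ≤ k per column j.
cross-cover : (k : ℕ) (P Q : Fin n → Subset m) → NoMutual k P →
  Σ[ C ∈ Subset m ] ∣ C ∣ ≤ n * k + n * k × CoversCritical k P Q C
cross-cover {n} {m} k P Q no-mutual = ⋃ᶠ K ∪ D , size , covers
  where
  cover : Σ[ D ∈ Subset m ] ∣ D ∣ ≤ n * k × RankedCover P D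
  cover = ranked-cover k P no-mutual

  D : Subset m
  D = proj₁ cover

  column : ∀ j → Σ[ K ∈ Subset m ] ∣ K ∣ ≤ k × (∀ i → ∣ P i ─ Q j ∣ ≤ k → P i ─ Q j ⊆ K ∪ D)
  column j = critical-cover k P (proj₂ (proj₂ cover)) (Q j)
  K : Fin n → Subset m
  K j = proj₁ (column j)

  size : ∣ ⋃ᶠ K ∪ D ∣ ≤ n * k + n * k
  size = ≤-trans (∣p∪q∣≤∣p∣+∣q∣ (⋃ᶠ K) D)
    (+-mono-≤ (∣⋃ᶠ∣≤ k K (λ j → proj₁ (proj₂ (column j)))) (proj₁ (proj₂ cover)))

  covers : CoversCritical k P Q (⋃ᶠ K ∪ D)
  covers i j small x∈ with x∈p∪q⁻ (K j) D (proj₂ (proj₂ (column j)) i small x∈)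
  ... | inj₁ x∈K = x∈p∪q⁺ (inj₁ (f⊆⋃ᶠf K j x∈K))
  ... | inj₂ x∈D = x∈p∪q⁺ (inj₂ x∈D)

-- Deleting an element x that is critical for no edge preserves a
-- representation: edges keep differences of size ≥ k, and differences of
-- non-edges only shrink, since deletion turns F u ─ F v into (F u ─ F v) - x.
delete-noncritical : {V : Set} (k : ℕ) (G : Graph V) (F : V → Subset m) (x : Fin m) →
  IsKMinDiffRep k G F →
  (∀ u v → Adj G u v → x ∈ F u ─ F v → k < ∣ F u ─ F v ∣) →
  IsKMinDiffRep k G (delete x F)
delete-noncritical k G F x rep noncritical u v u≢v = mk⇔ to from
  where
  difference-after : ∀ u v → (F u - x) ─ (F v - x) ≡ (F u ─ F v) - x
  difference-after u v = ─-distrib (F u) (F v) ⁅ x ⁆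

  stays-large : ∀ u v → Adj G u v → k ≤ ∣ F u ─ F v ∣ → k ≤ ∣ (F u - x) ─ (F v - x) ∣
  stays-large u v adj k≤ = subst (λ s → k ≤ ∣ s ∣) (≡-sym (difference-after u v))
    (deletion-keeps-large k (F u ─ F v) x k≤ (noncritical u v adj))

  shrinks : ∀ u v → ∣ (F u - x) ─ (F v - x) ∣ ≤ ∣ F u ─ F v ∣
  shrinks u v = subst (λ s → ∣ s ∣ ≤ ∣ F u ─ F v ∣) (≡-sym (difference-after u v))
    (∣p─q∣≤∣p∣ (F u ─ F v) ⁅ x ⁆)

  to : Adj G u v → MinDiff k (F u - x) (F v - x)
  to adj = stays-large u v adj (proj₁ md) , stays-large v u (sym G adj) (proj₂ md)
    where md = Equivalence.to (rep u v u≢v) adj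

  from : MinDiff k (F u - x) (F v - x) → Adj G u v
  from (k≤uv , k≤vu) =
    Equivalence.from (rep u v u≢v) (≤-trans k≤uv (shrinks u v) , ≤-trans k≤vu (shrinks v u))

reduced⇒critical : (k : ℕ) (G : Graph (BVert n)) (F : BVert n → Subset m) →
  IsKMinDiffRep k G F → IsReduced k G F → (C : Subset m) →
  (∀ u v → Adj G u v → ∣ F u ─ F v ∣ ≤ k → F u ─ F v ⊆ C) →
  unionOver (allBVert n) F ⊆ C
reduced⇒critical k G F rep reduced C critical⊆C {x} x∈union with x ∈? C
... | yes x∈C = x∈C
... | no x∉C = ⊥-elim (reduced x x∈union (delete-noncritical k G F x rep noncritical))
  where
  noncritical : ∀ u v → Adj G u v → x ∈ F u ─ F v → k < ∣ F u ─ F v ∣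
  noncritical u v adj x∈ with ∣ F u ─ F v ∣ ≤? k
  ... | yes small = contradiction (critical⊆C u v adj small x∈) x∉C
  ... | no large = ≰⇒> large

min-diff⇒≢ : {k : ℕ} {p q : Subset m} → 1 ≤ k → MinDiff k p q → p ≢ q
min-diff⇒≢ {p = p} 1≤k (k≤∣p─q∣ , _) refl =
  contradiction (≤-trans 1≤k (≤-trans k≤∣p─q∣ (≤-reflexive (∣p─p∣≡0 p)))) λ ()

independent⇒no-mutual : {V : Set} (k : ℕ) (G : Graph V) (F : V → Subset m) →
  1 ≤ k → IsKMinDiffRep k G F → (f : Fin n → V) → (∀ i j → ¬ Adj G (f i) (f j)) →
  NoMutual k (λ i → F (f i))
independent⇒no-mutual k G F 1≤k rep f independent i j md =
  independent i j (Equivalence.from (rep (f i) (f j) (λ e → min-diff⇒≢ 1≤k md (cong F e))) md)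

bipartite-critical : (k : ℕ) (G : Graph (BVert n)) (F : BVert n → Subset m) →
  IsBipartite G → (C₁ C₂ : Subset m) →
  CoversCritical k (λ i → F (inj₁ i)) (λ j → F (inj₂ j)) C₁ →
  CoversCritical k (λ j → F (inj₂ j)) (λ i → F (inj₁ i)) C₂ →
  ∀ u v → Adj G u v → ∣ F u ─ F v ∣ ≤ k → F u ─ F v ⊆ C₁ ∪ C₂
bipartite-critical k G F (independent₁ , _) _ _ _ _ (inj₁ i) (inj₁ j) adj =
  contradiction adj (independent₁ i j)
bipartite-critical k G F _ C₁ C₂ cover₁ _ (inj₁ i) (inj₂ j) adj small x∈ =
  x∈p∪q⁺ (inj₁ (cover₁ i j small x∈))
bipartite-critical k G F _ C₁ C₂ _ cover₂ (inj₂ j) (inj₁ i) adj small x∈ =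
  x∈p∪q⁺ (inj₂ (cover₂ j i small x∈))
bipartite-critical k G F (_ , independent₂) _ _ _ _ (inj₂ i) (inj₂ j) adj =
  contradiction adj (independent₂ i j)

-- Two cross covers of size 2nk each.
4kn : (n k : ℕ) → (n * k + n * k) + (n * k + n * k) ≡ 4 * k * n
4kn = solve-∀

lemma5 : (n k m : ℕ) → 1 ≤ k → (G : Graph (BVert n)) → IsBipartite G → (F : BVert n → Subset m) → IsKMinDiffRep k G F → IsReduced k G F → ∣ unionOver (allBVert n) F ∣ ≤ 4 * k * n
lemma5 n k m 1≤k G bipartite F rep reduced = begin
  ∣ unionOver (allBVert n) F ∣        ≤⟨ p⊆q⇒∣p∣≤∣q∣ union⊆C₁∪C₂ ⟩
  ∣ C₁ ∪ C₂ ∣                         ≤⟨ ∣p∪q∣≤∣p∣+∣q∣ C₁ C₂ ⟩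
  ∣ C₁ ∣ + ∣ C₂ ∣                     ≤⟨ +-mono-≤ (proj₁ (proj₂ AB)) (proj₁ (proj₂ BA)) ⟩
  (n * k + n * k) + (n * k + n * k)   ≡⟨ 4kn n k ⟩
  4 * k * n                           ∎
  where
  open ≤-Reasoning
  A B : Fin n → Subset m
  A i = F (inj₁ i)
  B j = F (inj₂ j)

  CrossCover : (Fin n → Subset m) → (Fin n → Subset m) → Set
  CrossCover P Q = Σ[ C ∈ Subset m ] ∣ C ∣ ≤ n * k + n * k × CoversCritical k P Q C

  AB : CrossCover A B
  AB = cross-cover k A B (independent⇒no-mutual k G F 1≤k rep inj₁ (proj₁ bipartite))

  BA : CrossCover B A
  BA = cross-cover k B A (independent⇒no-mutual k G F 1≤k rep inj₂ (proj₂ bipartite))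

  C₁ C₂ : Subset m
  C₁ = proj₁ AB
  C₂ = proj₁ BA

  union⊆C₁∪C₂ : unionOver (allBVert n) F ⊆ C₁ ∪ C₂
  union⊆C₁∪C₂ = reduced⇒critical k G F rep reduced (C₁ ∪ C₂)
    (bipartite-critical k G F bipartite C₁ C₂ (proj₂ (proj₂ AB)) (proj₂ (proj₂ BA)))
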